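{- Let $b\geq2$, $q\in\mathbb{N}$ and $a\in\mathbb{Z}$ with $(a,q)=1$. Then $$\sum_{r\ (\mathrm{mod}\ q)}e\Big(\frac{ra}{q}\Big)\rho_b(r,q)=\mu(q)\,\mathbb{1}_{q\mid b^3-b},$$ where $\mathbb{1}_{q\mid b^3-b}$ equals $1$ if $q\mid b^3-b$ and $0$ otherwise.
   Context: $e(x)=\exp(2\pi ix)$, $\mu$ is the Möbius function, $(\cdot,\cdot)$ denotes gcd, and $\rho_b(r,q)=1$ if $(r,q,b^3-b)=1$ and $\rho_b(r,q)=0$ otherwise. -}

module Defs where

open import Level using (Level)
open import Data.Bool using (Bool; true; false; if_then_else_)
open import Data.Nat as ℕ using (ℕ; zero; suc; _∸_; _^_)
open import Data.Nat.Divisibility using (_∣?_)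
open import Data.Nat.GCD using (gcd)
open import Data.Nat.Primality using (prime?)
open import Data.Integer as ℤ using (ℤ; +_; -[1+_])
open import Data.Integer.DivMod using (_%ℕ_)
open import Data.List using (List; upTo; filter; length)
open import Data.Bool.ListAction using (any)
open import Relation.Nullary.Decidable using (⌊_⌋; _×-dec_)
open import Algebra.Bundles using (CommutativeRing)

-- Möbius function μ : ℕ → ℤ (μ 0 = 0 by convention; only μ q for q ≥ 1 is used).
-- μ n = 0 if d² ∣ n for some 2 ≤ d ≤ n, else (-1)^(number of primes p ≤ n with p ∣ n).
squareDivisor : ℕ → Bool
squareDivisor n = any (λ d → ⌊ (2 ℕ.≤? d) ×-dec ((d ℕ.* d) ∣? n) ⌋) (upTo (suc n))

numPrimeDivisors : ℕ → ℕ
numPrimeDivisors n = length (filter (λ p → prime? p ×-dec (p ∣? n)) (upTo (suc n)))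

negOnePow : ℕ → ℤ
negOnePow zero = + 1
negOnePow (suc k) = ℤ.- negOnePow k

μ : ℕ → ℤ
μ zero = + 0
μ n@(suc _) = if squareDivisor n then + 0 else negOnePow (numPrimeDivisors n)

ρ : ℕ → ℕ → ℕ → Bool
ρ b r q = ⌊ gcd (gcd r q) (b ^ 3 ∸ b) ℕ.≟ 1 ⌋

divInd : ℕ → ℕ → ℤ
divInd b q = if ⌊ q ∣? (b ^ 3 ∸ b) ⌋ then + 1 else + 0

module RingOps {c ℓ : Level} (R : CommutativeRing c ℓ) where
  open CommutativeRing R

  pow : Carrier → ℕ → Carrier
  pow x zero = 1#
  pow x (suc n) = x * pow x n

  natR : ℕ → Carrier
  natR zero = 0#
  natR (suc n) = 1# + natR n

  intR : ℤ → Carrier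
  intR (+ n) = natR n
  intR -[1+ n ] = - natR (suc n)

  IsPrimitiveRoot : Carrier → ℕ → Set ℓ
  IsPrimitiveRoot ζ q = (pow ζ q ≈ 1#) × (∀ j → 0 ℕ.< j → j ℕ.< q → ¬ (pow ζ j ≈ 1#))
    where open import Data.Product using (_×_)
          open import Relation.Nullary using (¬_)

  -- Σ_{r mod q} e(ra/q) ρ_b(r,q), with e(k/q) realised as ζ^(k mod q)
  sumR : (ℕ → Carrier) → ℕ → Carrier
  sumR f zero = 0#
  sumR f (suc n) = sumR f n + f n

  expSum : Carrier → ℕ → ℕ → ℤ → Carrier
  expSum ζ b zero a = 0#
  expSum ζ b q@(suc _) a =
    sumR (λ r → if ρ b r q then pow ζ ((ℤ._*_ (+ r) a) %ℕ q) else 0#) q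

IsIntegralDomain : {c ℓ : Level} → CommutativeRing c ℓ → Set _
IsIntegralDomain R = ∀ x y → x * y ≈ 0# → (x ≈ 0#) ⊎ (y ≈ 0#)
  where open CommutativeRing R
        open import Data.Sum using (_⊎_)

-- Put u = ζ ^ (a mod q); since (a, q) = 1 it is again a primitive q-th root of unity, and the
-- summands become u ^ r.  As (r, q, b³ - b) = (r, g) with g = (q, b³ - b), the sum is
-- Σ_{r < q, (r, g) = 1} u ^ r.  If q ∤ b³ - b, then g is a proper divisor of q and the mask is
-- g-periodic, so multiplying by u ^ g ≠ 1 leaves the sum unchanged; in an integral domain the sum
-- therefore vanishes.  If q ∣ b³ - b, then g = q and the sum is the Ramanujan sum c_q(1) = μ(q).
-- This is proved by splitting off one prime at a time, q = n p: if p ∣ n, the same vanishing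
-- argument applies with period n; otherwise inclusion–exclusion over p ∣ r gives c_{np} = - c_n,
-- because u ^ p is a primitive n-th root of unity.

module Submission where

open import Defs
open import Data.Nat using (ℕ; zero; suc; _≤_)
open import Data.Nat.GCD using (gcd)
open import Data.Integer using (ℤ; ∣_∣)
open import Algebra.Bundles using (CommutativeRing)
open import Relation.Binary.PropositionalEquality using (_≡_)

module Arithmetic where

  open import Data.Bool using (Bool; true; false; T; if_then_else_; _∧_; not)
  open import Data.Bool.Properties using (T-≡)
  open import Data.Empty using (⊥-elim)
  open import Data.Integer as ℤ using (ℤ; +_) renaming (-_ to -ℤ_)
  import Data.Integer.Properties as ℤ
  import Data.Integer.Divisibility.Signed as Signed
  open import Data.Integer.DivMod using (_%ℕ_; _/ℕ_; a≡a%ℕn+[a/ℕn]*n)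
  open import Data.Integer.Tactic.RingSolver using (solve-∀)
  open import Data.List using ([]; _∷_; [_]; _++_; upTo; filter; length)
  open import Data.List.Membership.Propositional using (lose; find)
  open import Data.List.Membership.Propositional.Properties using (∈-upTo⁺)
  open import Data.List.Properties using (upTo-∷ʳ; filter-++; length-++)
  open import Data.List.Relation.Unary.All using (All; []; _∷_)
  open import Data.List.Relation.Unary.Any.Properties using (any⁺; any⁻)
  open import Data.Nat
  open import Data.Nat.Coprimality as Coprimality
    using (Coprime; coprime?; coprime-divisor; gcd≡1⇒coprime; coprime⇒gcd≡1)
  open import Data.Nat.Divisibility
  open import Data.Nat.GCD using (gcd; gcd-assoc; gcd-greatest)
  open import Data.Nat.ListAction using (product)
  open import Data.Nat.Primality
  open import Data.Nat.Primality.Factorisation using (factorise; PrimeFactorisation)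
  open import Data.Nat.Properties
  open import Data.Product using (∃-syntax; _×_; _,_; proj₂)
  open import Data.Sum using (inj₁; inj₂; [_,_]′; reduce)
  open import Function using (id; _∘_; _⇔_; Equivalence; mk⇔)
  open import Relation.Nullary using (Dec; yes; no; ¬_; contradiction)
  open import Relation.Nullary.Decidable
    using (⌊_⌋; isYes≗does; dec-true; dec-false; does-⇔; fromWitness; toWitness; _×-dec_)
  open import Relation.Binary.PropositionalEquality
    using (_≡_; _≢_; refl; sym; trans; cong; cong₂; subst; ≢-sym; module ≡-Reasoning)

  variable
    d m n p r : ℕ

  ⌊⌋-true : ∀ {a} {A : Set a} (a? : Dec A) → A → ⌊ a? ⌋ ≡ true
  ⌊⌋-true a? x = trans (isYes≗does a?) (dec-true a? x)

  ⌊⌋-false : ∀ {a} {A : Set a} (a? : Dec A) → ¬ A → ⌊ a? ⌋ ≡ false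
  ⌊⌋-false a? ¬x = trans (isYes≗does a?) (dec-false a? ¬x)

  ⌊⌋-⇔ : ∀ {a b} {A : Set a} {B : Set b} (a? : Dec A) (b? : Dec B) → (A → B) → (B → A) →
    ⌊ a? ⌋ ≡ ⌊ b? ⌋
  ⌊⌋-⇔ a? b? f g = trans (isYes≗does a?) (trans (does-⇔ (mk⇔ f g) a? b?) (sym (isYes≗does b?)))

  T-⇔⇒≡ : ∀ {x y} → T x ⇔ T y → x ≡ y
  T-⇔⇒≡ {false} {false} _    = refl
  T-⇔⇒≡ {false} {true}  x⇔y = ⊥-elim (Equivalence.from x⇔y _)
  T-⇔⇒≡ {true}  {false} x⇔y = ⊥-elim (Equivalence.to x⇔y _)
  T-⇔⇒≡ {true}  {true}  _    = refl

  periodic-multiple : ∀ {a} {A : Set a} (f : ℕ → A) {g} → (∀ r → f (r + g) ≡ f r) →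
    ∀ k r → f (r + k * g) ≡ f r
  periodic-multiple f     f-periodic zero    r = cong f (+-identityʳ r)
  periodic-multiple f {g} f-periodic (suc k) r = begin
    f (r + (g + k * g))   ≡⟨ cong f (+-assoc r g (k * g)) ⟨
    f (r + g + k * g)     ≡⟨ periodic-multiple f f-periodic k (r + g) ⟩
    f (r + g)             ≡⟨ f-periodic r ⟩
    f r                   ∎
    where open ≡-Reasoning

  prime-induction : ∀ {ℓ} (P : ℕ → Set ℓ) → P 1 →
    (∀ {n p} → .{{NonZero n}} → Prime p → P n → P (n * p)) →
    ∀ n → .{{NonZero n}} → P n
  prime-induction P P[1] step n = subst P (sym isFactorisation) (P[product] factors factorsPrime)
    where
    open PrimeFactorisation (factorise n)
    P[product] : ∀ ps → All Prime ps → P (product ps)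
    P[product] []       []         = P[1]
    P[product] (p ∷ ps) (pp ∷ pps) =
      subst P (*-comm (product ps) p) (step {{productOfPrimes≢0 pps}} pp (P[product] ps pps))

  prime>1 : Prime p → 1 < p
  prime>1 {p} pp = nonTrivial⇒n>1 p {{prime⇒nonTrivial pp}}

  -- Coprimality

  prime∤⇒coprime : Prime p → p ∤ n → Coprime n p
  prime∤⇒coprime pp p∤n {d} (d∣n , d∣p) with prime⇒irreducible pp d∣p
  ... | inj₁ d≡1  = d≡1
  ... | inj₂ refl = contradiction d∣n p∤n

  coprime∧prime∣⇒∤ : Prime p → Coprime r m → p ∣ m → p ∤ r
  coprime∧prime∣⇒∤ pp r⊥m p∣m p∣r = ¬prime[1] (subst Prime (r⊥m (p∣r , p∣m)) pp)

  coprime-∣ʳ : Coprime r m → n ∣ m → Coprime r n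
  coprime-∣ʳ r⊥m n∣m (d∣r , d∣n) = r⊥m (d∣r , ∣-trans d∣n n∣m)

  coprime-∣ˡ : Coprime m r → n ∣ m → Coprime n r
  coprime-∣ˡ m⊥r n∣m (d∣n , d∣r) = m⊥r (∣-trans d∣n n∣m , d∣r)

  coprime-*-prime : Prime p → Coprime r n → p ∤ r → Coprime r (n * p)
  coprime-*-prime {p} {r} {n} pp r⊥n p∤r {d} (d∣r , d∣n*p) = r⊥n (d∣r , d∣n)
    where
    d∣n : d ∣ n
    d∣n = coprime-divisor (prime∤⇒coprime pp (λ p∣d → p∤r (∣-trans p∣d d∣r)))
                          (subst (d ∣_) (*-comm n p) d∣n*p)

  coprimeTo : ℕ → ℕ → Bool
  coprimeTo q r = ⌊ coprime? r q ⌋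

  coprimeTo-+ : ∀ n r → coprimeTo n (r + n) ≡ coprimeTo n r
  coprimeTo-+ n r = ⌊⌋-⇔ (coprime? (r + n) n) (coprime? r n)
    (λ r+n⊥n {_} (d∣r , d∣n) → r+n⊥n (∣m∣n⇒∣m+n d∣r d∣n , d∣n))
    (λ r⊥n {d} (d∣r+n , d∣n) → r⊥n (∣m+n∣m⇒∣n (subst (d ∣_) (+-comm r n) d∣r+n) d∣n , d∣n))

  coprimeTo-*-prime : Prime p → ∀ r → coprimeTo (n * p) r ≡ coprimeTo n r ∧ not ⌊ p ∣? r ⌋
  coprimeTo-*-prime {p} {n} pp r with coprime? r n | p ∣? r
  ... | yes r⊥n | no p∤r  = ⌊⌋-true (coprime? r (n * p)) (coprime-*-prime pp r⊥n p∤r)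
  ... | yes _   | yes p∣r =
    ⌊⌋-false (coprime? r (n * p)) (λ r⊥np → coprime∧prime∣⇒∤ pp r⊥np (n∣m*n n) p∣r)
  ... | no ¬r⊥n | _       = ⌊⌋-false (coprime? r (n * p)) (λ r⊥np → ¬r⊥n (coprime-∣ʳ r⊥np (m∣m*n p)))

  coprimeTo-*-prime-∣ : Prime p → p ∣ n → ∀ r → coprimeTo (n * p) r ≡ coprimeTo n r
  coprimeTo-*-prime-∣ {p} {n} pp p∣n r = ⌊⌋-⇔ (coprime? r (n * p)) (coprime? r n)
    (λ r⊥np → coprime-∣ʳ r⊥np (m∣m*n p))
    (λ r⊥n → coprime-*-prime pp r⊥n (coprime∧prime∣⇒∤ pp r⊥n p∣n))

  coprimeTo-prime-* : Prime p → p ∤ n → ∀ s → coprimeTo n (s * p) ≡ coprimeTo n s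
  coprimeTo-prime-* {p} {n} pp p∤n s = ⌊⌋-⇔ (coprime? (s * p) n) (coprime? s n)
    (λ sp⊥n → coprime-∣ˡ sp⊥n (m∣m*n p))
    (λ s⊥n → Coprimality.sym (coprime-*-prime pp (Coprimality.sym s⊥n) p∤n))

  ρ≡coprimeTo-gcd : ∀ b r q → ρ b r q ≡ coprimeTo (gcd q (b ^ 3 ∸ b)) r
  ρ≡coprimeTo-gcd b r q = trans (cong (λ g → ⌊ g ≟ 1 ⌋) (gcd-assoc r q (b ^ 3 ∸ b)))
    (⌊⌋-⇔ (gcd r (gcd q (b ^ 3 ∸ b)) ≟ 1) (coprime? r (gcd q (b ^ 3 ∸ b))) gcd≡1⇒coprime coprime⇒gcd≡1)

  -- The Möbius function

  countBelow : (ℕ → Bool) → ℕ → ℕ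
  countBelow f zero    = 0
  countBelow f (suc k) = if f k then suc (countBelow f k) else countBelow f k

  length-filter-upTo : ∀ {P : ℕ → Set} (P? : ∀ x → Dec (P x)) k →
    length (filter P? (upTo k)) ≡ countBelow (λ x → ⌊ P? x ⌋) k
  length-filter-upTo P? zero    = refl
  length-filter-upTo P? (suc k) = begin
    length (filter P? (upTo (suc k)))
      ≡⟨ cong (length ∘ filter P?) (upTo-∷ʳ k) ⟨
    length (filter P? (upTo k ++ [ k ]))
      ≡⟨ cong length (filter-++ P? (upTo k) [ k ]) ⟩
    length (filter P? (upTo k) ++ filter P? [ k ])
      ≡⟨ length-++ (filter P? (upTo k)) ⟩
    length (filter P? (upTo k)) + length (filter P? [ k ])
      ≡⟨ cong₂ _+_ (length-filter-upTo P? k) length-filter-[k] ⟩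
    countBelow (λ x → ⌊ P? x ⌋) k + (if ⌊ P? k ⌋ then 1 else 0)
      ≡⟨ +-if ⌊ P? k ⌋ ⟩
    countBelow (λ x → ⌊ P? x ⌋) (suc k)
      ∎
    where
    open ≡-Reasoning
    length-filter-[k] : length (filter P? [ k ]) ≡ (if ⌊ P? k ⌋ then 1 else 0)
    length-filter-[k] with P? k
    ... | yes _ = refl
    ... | no _  = refl
    +-if : ∀ b {c} → c + (if b then 1 else 0) ≡ (if b then suc c else c)
    +-if true  {c} = +-comm c 1
    +-if false {c} = +-identityʳ c

  countBelow-cong : ∀ {f g} k → (∀ {x} → x < k → f x ≡ g x) → countBelow f k ≡ countBelow g k
  countBelow-cong zero    _   = refl
  countBelow-cong (suc k) f≗g
    rewrite f≗g (n<1+n k) | countBelow-cong k (λ x<k → f≗g (m<n⇒m<1+n x<k)) = refl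

  countBelow-insert : ∀ {f g p} k → p < k → f p ≡ true → g p ≡ false →
    (∀ {x} → x ≢ p → f x ≡ g x) → countBelow f k ≡ suc (countBelow g k)
  countBelow-insert {f} {g} {p} (suc k) p<1+k fp gp f≗g with k ≟ p
  ... | yes refl rewrite fp | gp = cong suc (countBelow-cong k (λ x<k → f≗g (<⇒≢ x<k)))
  ... | no k≢p
    rewrite f≗g k≢p | countBelow-insert k (≤∧≢⇒< (≤-pred p<1+k) (≢-sym k≢p)) fp gp f≗g
    with g k
  ...   | true  = refl
  ...   | false = refl

  countBelow-beyond : ∀ {f m} k → m ≤ k → (∀ {x} → m ≤ x → f x ≡ false) →
    countBelow f k ≡ countBelow f m
  countBelow-beyond k m≤k f≡false with m≤n⇒m<n∨m≡n m≤k
  ... | inj₂ refl = refl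
  countBelow-beyond (suc k) _ f≡false | inj₁ m<1+k
    rewrite f≡false (≤-pred m<1+k) = countBelow-beyond k (≤-pred m<1+k) f≡false

  numPrimeDivisors-*-prime : Prime p → p ∤ n → .{{NonZero n}} →
    numPrimeDivisors (n * p) ≡ suc (numPrimeDivisors n)
  numPrimeDivisors-*-prime {p} {n} pp p∤n = begin
    numPrimeDivisors (n * p)
      ≡⟨ length-filter-upTo (primeDivisor? (n * p)) (suc (n * p)) ⟩
    countBelow (pd (n * p)) (suc (n * p))
      ≡⟨ countBelow-insert (suc (n * p)) (s≤s (m≤n*m p n)) pd[np,p] pd[n,p] pd-agree ⟩
    suc (countBelow (pd n) (suc (n * p)))
      ≡⟨ cong suc (countBelow-beyond (suc (n * p)) (s≤s (m≤m*n n p)) pd-large) ⟩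
    suc (countBelow (pd n) (suc n))
      ≡⟨ cong suc (length-filter-upTo (primeDivisor? n) (suc n)) ⟨
    suc (numPrimeDivisors n)
      ∎
    where
    open ≡-Reasoning
    instance _ = prime⇒nonZero pp
    primeDivisor? : ∀ m x → Dec (Prime x × x ∣ m)
    primeDivisor? m x = prime? x ×-dec x ∣? m
    pd : ℕ → ℕ → Bool
    pd m x = ⌊ primeDivisor? m x ⌋
    pd[np,p] : pd (n * p) p ≡ true
    pd[np,p] = ⌊⌋-true (primeDivisor? (n * p) p) (pp , n∣m*n n)
    pd[n,p] : pd n p ≡ false
    pd[n,p] = ⌊⌋-false (primeDivisor? n p) (p∤n ∘ proj₂)
    pd-agree : ∀ {x} → x ≢ p → pd (n * p) x ≡ pd n x
    pd-agree {x} x≢p = ⌊⌋-⇔ (primeDivisor? (n * p) x) (primeDivisor? n x)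
      (λ (px , x∣np) → px , [ id , (λ x∣p → contradiction (prime∣p px x∣p) x≢p) ]′
                                  (euclidsLemma n p px x∣np))
      (λ (px , x∣n) → px , ∣m⇒∣m*n p x∣n)
      where
      prime∣p : Prime x → x ∣ p → x ≡ p
      prime∣p px x∣p =
        [ (λ x≡1 → contradiction (subst Prime x≡1 px) ¬prime[1]) , id ]′ (prime⇒irreducible pp x∣p)
    pd-large : ∀ {x} → suc n ≤ x → pd n x ≡ false
    pd-large {x} n<x = ⌊⌋-false (primeDivisor? n x) (λ (_ , x∣n) → <⇒≱ n<x (∣⇒≤ x∣n))

  squareFactor? : ∀ n d → Dec (2 ≤ d × d * d ∣ n)
  squareFactor? n d = (2 ≤? d) ×-dec (d * d ∣? n)

  squareDivisor-intro : .{{NonZero n}} → 2 ≤ d → d * d ∣ n → T (squareDivisor n)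
  squareDivisor-intro {n} {d} 2≤d d*d∣n = any⁺ (λ d → ⌊ squareFactor? n d ⌋)
    (lose (∈-upTo⁺ (s≤s d≤n)) (fromWitness {a? = squareFactor? n d} (2≤d , d*d∣n)))
    where
    instance _ = >-nonZero (≤-trans (s≤s z≤n) 2≤d)
    d≤n : d ≤ n
    d≤n = ≤-trans (m≤m*n d d) (∣⇒≤ d*d∣n)

  squareDivisor-elim : T (squareDivisor n) → ∃[ d ] 2 ≤ d × d * d ∣ n
  squareDivisor-elim {n} sq with find (any⁻ (λ d → ⌊ squareFactor? n d ⌋) (upTo (suc n)) sq)
  ... | d , _ , t = d , toWitness t

  squareDivisor-*-prime : Prime p → p ∤ n → .{{NonZero n}} → squareDivisor (n * p) ≡ squareDivisor n
  squareDivisor-*-prime {p} {n} pp p∤n =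
    T-⇔⇒≡ (mk⇔ (drop-p ∘ squareDivisor-elim) (add-p ∘ squareDivisor-elim))
    where
    instance
      _ = prime⇒nonZero pp
      _ = m*n≢0 n p
    drop-p : ∃[ d ] 2 ≤ d × d * d ∣ n * p → T (squareDivisor n)
    drop-p (d , 2≤d , d*d∣np) =
      squareDivisor-intro 2≤d (coprime-divisor (prime∤⇒coprime pp p∤d*d) (subst (d * d ∣_) (*-comm n p) d*d∣np))
      where
      p∤d*d : p ∤ d * d
      p∤d*d p∣d*d = p∤n (*-cancelʳ-∣ p (∣-trans (*-pres-∣ p∣d p∣d) d*d∣np))
        where p∣d = reduce (euclidsLemma d d pp p∣d*d)
    add-p : ∃[ d ] 2 ≤ d × d * d ∣ n → T (squareDivisor (n * p))
    add-p (d , 2≤d , d*d∣n) = squareDivisor-intro 2≤d (∣m⇒∣m*n p d*d∣n)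

  μ-nonZero : ∀ n → .{{NonZero n}} →
    μ n ≡ (if squareDivisor n then + 0 else negOnePow (numPrimeDivisors n))
  μ-nonZero (suc n) = refl

  μ-*-prime-∣ : Prime p → p ∣ n → .{{NonZero n}} → μ (n * p) ≡ + 0
  μ-*-prime-∣ {p} {n} pp p∣n =
    trans (μ-nonZero (n * p)) (cong (λ b → if b then + 0 else negOnePow (numPrimeDivisors (n * p))) np-has-square)
    where
    instance
      _ = prime⇒nonZero pp
      _ = m*n≢0 n p
    np-has-square : squareDivisor (n * p) ≡ true
    np-has-square = Equivalence.to T-≡ (squareDivisor-intro (prime>1 pp) (*-monoˡ-∣ p p∣n))

  μ-*-prime-∤ : Prime p → p ∤ n → .{{NonZero n}} → μ (n * p) ≡ -ℤ μ n
  μ-*-prime-∤ {p} {n} pp p∤n = begin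
    μ (n * p)
      ≡⟨ μ-nonZero (n * p) ⟩
    (if squareDivisor (n * p) then + 0 else negOnePow (numPrimeDivisors (n * p)))
      ≡⟨ cong₂ (λ b k → if b then + 0 else negOnePow k)
               (squareDivisor-*-prime pp p∤n) (numPrimeDivisors-*-prime pp p∤n) ⟩
    (if squareDivisor n then + 0 else -ℤ negOnePow (numPrimeDivisors n))
      ≡⟨ if-neg (squareDivisor n) ⟩
    -ℤ (if squareDivisor n then + 0 else negOnePow (numPrimeDivisors n))
      ≡⟨ cong -ℤ_ (μ-nonZero n) ⟨
    -ℤ μ n
      ∎
    where
    open ≡-Reasoning
    instance
      _ = prime⇒nonZero pp
      _ = m*n≢0 n p
    if-neg : ∀ b {x} → (if b then + 0 else -ℤ x) ≡ -ℤ (if b then + 0 else x)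
    if-neg true  = refl
    if-neg false = refl

  -- Congruences

  x≡y+kq⇒y≡x-kq : ∀ {x y k q : ℤ} → x ≡ y ℤ.+ k ℤ.* q → y ≡ x ℤ.+ (-ℤ k) ℤ.* q
  x≡y+kq⇒y≡x-kq {x} {y} {k} {q} x≡y+kq = begin
    y                                   ≡⟨ add-sub y k q ⟩
    (y ℤ.+ k ℤ.* q) ℤ.+ (-ℤ k) ℤ.* q    ≡⟨ cong (ℤ._+ (-ℤ k) ℤ.* q) x≡y+kq ⟨
    x ℤ.+ (-ℤ k) ℤ.* q                  ∎
    where
    open ≡-Reasoning
    add-sub : ∀ y k q → y ≡ (y ℤ.+ k ℤ.* q) ℤ.+ (-ℤ k) ℤ.* q
    add-sub = solve-∀

  [r*a]%ℕq≡[a%ℕq]*r+kq : ∀ q .{{_ : NonZero q}} r a →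
    + ((+ r ℤ.* a) %ℕ q) ≡ + ((a %ℕ q) * r) ℤ.+ (+ r ℤ.* (a /ℕ q) ℤ.- (+ r ℤ.* a) /ℕ q) ℤ.* + q
  [r*a]%ℕq≡[a%ℕq]*r+kq q r a = begin
    + x
      ≡⟨ add-sub (+ x) k₂ (+ q) ⟩
    (+ x ℤ.+ k₂ ℤ.* + q) ℤ.- k₂ ℤ.* + q
      ≡⟨ cong (ℤ._- k₂ ℤ.* + q) (a≡a%ℕn+[a/ℕn]*n (+ r ℤ.* a) q) ⟨
    + r ℤ.* a ℤ.- k₂ ℤ.* + q
      ≡⟨ cong (λ a → + r ℤ.* a ℤ.- k₂ ℤ.* + q) (a≡a%ℕn+[a/ℕn]*n a q) ⟩
    + r ℤ.* (+ a′ ℤ.+ k₁ ℤ.* + q) ℤ.- k₂ ℤ.* + q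
      ≡⟨ regroup (+ r) (+ a′) k₁ k₂ (+ q) ⟩
    + a′ ℤ.* + r ℤ.+ (+ r ℤ.* k₁ ℤ.- k₂) ℤ.* + q
      ≡⟨ cong (ℤ._+ (+ r ℤ.* k₁ ℤ.- k₂) ℤ.* + q) (ℤ.pos-* a′ r) ⟨
    + (a′ * r) ℤ.+ (+ r ℤ.* k₁ ℤ.- k₂) ℤ.* + q
      ∎
    where
    open ≡-Reasoning
    x = (+ r ℤ.* a) %ℕ q
    a′ = a %ℕ q
    k₁ = a /ℕ q
    k₂ = (+ r ℤ.* a) /ℕ q
    add-sub : ∀ x k q → x ≡ (x ℤ.+ k ℤ.* q) ℤ.- k ℤ.* q
    add-sub = solve-∀
    regroup : ∀ r a k₁ k₂ q →
      r ℤ.* (a ℤ.+ k₁ ℤ.* q) ℤ.- k₂ ℤ.* q ≡ a ℤ.* r ℤ.+ (r ℤ.* k₁ ℤ.- k₂) ℤ.* q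
    regroup = solve-∀

  gcd≡1⇒coprime-%ℕ : ∀ {q} .{{_ : NonZero q}} a → gcd ℤ.∣ a ∣ q ≡ 1 → Coprime q (a %ℕ q)
  gcd≡1⇒coprime-%ℕ {q} a gcd≡1 {d} (d∣q , d∣a%q) =
    ∣1⇒≡1 (subst (d ∣_) gcd≡1 (gcd-greatest d∣∣a∣ d∣q))
    where
    d∣∣a∣ : d ∣ ℤ.∣ a ∣
    d∣∣a∣ = Signed.∣⇒∣ᵤ (subst (+ d Signed.∣_) (sym (a≡a%ℕn+[a/ℕn]*n a q))
      (Signed.∣m∣n⇒∣m+n (Signed.∣ᵤ⇒∣ {i = + (a %ℕ q)} d∣a%q)
                        (Signed.∣n⇒∣m*n (a /ℕ q) (Signed.∣ᵤ⇒∣ {i = + q} d∣q))))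

module PowerSums {c ℓ} (R : CommutativeRing c ℓ) where

  open import Algebra.Properties.CommutativeSemigroup (CommutativeRing.+-commutativeSemigroup R)
    using (interchange)
  open import Algebra.Properties.Ring (CommutativeRing.ring R) using (+-cancelˡ; -‿+-comm; -0#≈0#)
  open import Algebra.Properties.Semiring.Exp (CommutativeRing.semiring R)
    using (_^_; ^-congˡ; ^-homo-*; ^-assocʳ)
  open import Data.Bool using (Bool; true; false; if_then_else_; _∧_; not)
  open import Data.Integer as ℤ using (+_; -[1+_])
  import Data.Integer.Properties as ℤ
  open import Data.Integer.DivMod using (_%ℕ_)
  open import Data.Nat as ℕ using (ℕ; zero; suc; _<_; s≤s; NonZero)
  open import Data.Nat.Coprimality using (Coprime; coprime-divisor)
  open import Data.Nat.DivMod using (_%_; _/_; m≡m%n+[m/n]*n; m%n<n)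
  open import Data.Nat.Divisibility
    using (_∣_; _∣?_; divides; n∣m*n; ∣m+n∣m⇒∣n; ∣⇒≤; ∣-reflexive; *-cancelʳ-∣; m%n≡0⇒n∣m)
  import Data.Nat.Properties as ℕ
  open import Data.Product using (_,_; proj₁)
  open import Function using (_∘_)
  open import Relation.Nullary using (contradiction)
  open import Relation.Nullary.Decidable using (⌊_⌋)
  open import Relation.Binary.PropositionalEquality as ≡ using (_≡_)
  open Arithmetic
    using (⌊⌋-true; ⌊⌋-false; coprimeTo; ρ≡coprimeTo-gcd; x≡y+kq⇒y≡x-kq; [r*a]%ℕq≡[a%ℕq]*r+kq)
  open CommutativeRing R
  open RingOps R
  open import Relation.Binary.Reasoning.Setoid setoid

  pow≡^ : ∀ x n → pow x n ≡ x ^ n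
  pow≡^ x zero    = ≡.refl
  pow≡^ x (suc n) = ≡.cong (x *_) (pow≡^ x n)

  pow-+ : ∀ x m n → pow x (m ℕ.+ n) ≈ pow x m * pow x n
  pow-+ x m n rewrite pow≡^ x (m ℕ.+ n) | pow≡^ x m | pow≡^ x n = ^-homo-* x m n

  pow-* : ∀ x m n → pow x (m ℕ.* n) ≈ pow (pow x m) n
  pow-* x m n rewrite pow≡^ (pow x m) n | pow≡^ x (m ℕ.* n) | pow≡^ x m = sym (^-assocʳ x m n)

  pow-congˡ : ∀ {x y} n → x ≈ y → pow x n ≈ pow y n
  pow-congˡ {x} {y} n x≈y rewrite pow≡^ x n | pow≡^ y n = ^-congˡ n x≈y

  1^n≈1 : ∀ n → pow 1# n ≈ 1#
  1^n≈1 zero    = refl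
  1^n≈1 (suc n) = trans (*-identityˡ _) (1^n≈1 n)

  pow-periodic : ∀ {x m} → pow x m ≈ 1# → ∀ r → pow x (r ℕ.+ m) ≈ pow x r
  pow-periodic {x} {m} x^m≈1 r = begin
    pow x (r ℕ.+ m)       ≈⟨ pow-+ x r m ⟩
    pow x r * pow x m     ≈⟨ *-congˡ x^m≈1 ⟩
    pow x r * 1#          ≈⟨ *-identityʳ _ ⟩
    pow x r               ∎

  ∣⇒pow≈1 : ∀ {x q n} → pow x q ≈ 1# → q ∣ n → pow x n ≈ 1#
  ∣⇒pow≈1 {x} {q} x^q≈1 (divides k ≡.refl) = begin
    pow x (k ℕ.* q)       ≡⟨ ≡.cong (pow x) (ℕ.*-comm k q) ⟩
    pow x (q ℕ.* k)       ≈⟨ pow-* x q k ⟩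
    pow (pow x q) k       ≈⟨ pow-congˡ k x^q≈1 ⟩
    pow 1# k              ≈⟨ 1^n≈1 k ⟩
    1#                    ∎

  pow-≡-mod : ∀ {ζ q} → pow ζ q ≈ 1# → ∀ x y k → + x ≡ + y ℤ.+ k ℤ.* + q → pow ζ x ≈ pow ζ y
  pow-≡-mod {ζ} {q} ζ^q≈1 x y (+ n) x≡y+nq = begin
    pow ζ x                  ≡⟨ ≡.cong (pow ζ) (ℤ.+-injective x≡y+nq′) ⟩
    pow ζ (y ℕ.+ n ℕ.* q)    ≈⟨ pow-periodic (∣⇒pow≈1 ζ^q≈1 (n∣m*n n)) y ⟩
    pow ζ y                  ∎
    where
    x≡y+nq′ : + x ≡ + (y ℕ.+ n ℕ.* q)
    x≡y+nq′ = ≡.trans x≡y+nq (≡.sym (≡.trans (ℤ.pos-+ y (n ℕ.* q)) (≡.cong (ℤ._+_ (+ y)) (ℤ.pos-* n q))))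
  pow-≡-mod {ζ} {q} ζ^q≈1 x y -[1+ n ] x≡y+kq =
    sym (pow-≡-mod {ζ} {q} ζ^q≈1 y x (+ suc n) (x≡y+kq⇒y≡x-kq {k = -[1+ n ]} {q = + q} x≡y+kq))

  pow-%ℕ : ∀ {ζ q} → .{{_ : NonZero q}} → pow ζ q ≈ 1# →
    ∀ r a → pow ζ ((+ r ℤ.* a) %ℕ q) ≈ pow (pow ζ (a %ℕ q)) r
  pow-%ℕ {ζ} {q} ζ^q≈1 r a = trans
    (pow-≡-mod ζ^q≈1 ((+ r ℤ.* a) %ℕ q) (a %ℕ q ℕ.* r) (+ r ℤ.* (a ℤ./ℕ q) ℤ.- (+ r ℤ.* a) ℤ./ℕ q)
               ([r*a]%ℕq≡[a%ℕq]*r+kq q r a))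
    (pow-* ζ (a %ℕ q) r)

  pow≈1⇒∣ : ∀ {ζ q} → .{{NonZero q}} → IsPrimitiveRoot ζ q → ∀ n → pow ζ n ≈ 1# → q ∣ n
  pow≈1⇒∣ {ζ} {q} (ζ^q≈1 , minimal) n ζ^n≈1 with n % q in n%q≡r
  ... | zero  = m%n≡0⇒n∣m n q n%q≡r
  ... | suc r = contradiction ζ^[1+r]≈1 (minimal (suc r) ℕ.z<s (≡.subst (_< q) n%q≡r (m%n<n n q)))
    where
    ζ^[1+r]≈1 : pow ζ (suc r) ≈ 1#
    ζ^[1+r]≈1 = begin
      pow ζ (suc r)                     ≈⟨ pow-periodic (∣⇒pow≈1 ζ^q≈1 (n∣m*n (n / q))) (suc r) ⟨
      pow ζ (suc r ℕ.+ (n / q) ℕ.* q)   ≡⟨ ≡.cong (λ t → pow ζ (t ℕ.+ (n / q) ℕ.* q)) n%q≡r ⟨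
      pow ζ (n % q ℕ.+ (n / q) ℕ.* q)   ≡⟨ ≡.cong (pow ζ) (m≡m%n+[m/n]*n n q) ⟨
      pow ζ n                           ≈⟨ ζ^n≈1 ⟩
      1#                                ∎

  primitive-intro : ∀ {ζ q} → .{{NonZero q}} → pow ζ q ≈ 1# → (∀ n → pow ζ n ≈ 1# → q ∣ n) →
    IsPrimitiveRoot ζ q
  primitive-intro ζ^q≈1 order∣ =
    ζ^q≈1 , λ j 0<j j<q ζ^j≈1 → ℕ.<⇒≱ j<q (∣⇒≤ {{ℕ.>-nonZero 0<j}} (order∣ j ζ^j≈1))

  primitive-pow-coprime : ∀ {ζ q a} → .{{NonZero q}} → IsPrimitiveRoot ζ q → Coprime q a →
    IsPrimitiveRoot (pow ζ a) q
  primitive-pow-coprime {ζ} {q} {a} ζ-primitive q⊥a = primitive-intro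
    (trans (sym (pow-* ζ a q)) (∣⇒pow≈1 (proj₁ ζ-primitive) (n∣m*n a)))
    (λ n ζ^[a*n]≈1 → coprime-divisor q⊥a (pow≈1⇒∣ ζ-primitive (a ℕ.* n) (trans (pow-* ζ a n) ζ^[a*n]≈1)))

  primitive-pow-factor : ∀ {ζ n k} → .{{NonZero n}} → .{{NonZero k}} → IsPrimitiveRoot ζ (n ℕ.* k) →
    IsPrimitiveRoot (pow ζ k) n
  primitive-pow-factor {ζ} {n} {k} ζ-primitive = primitive-intro
    (trans (sym (pow-* ζ k n)) (∣⇒pow≈1 (proj₁ ζ-primitive) (∣-reflexive (ℕ.*-comm n k))))
    (λ m ζ^[k*m]≈1 → *-cancelʳ-∣ k (≡.subst (n ℕ.* k ∣_) (ℕ.*-comm k m)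
      (pow≈1⇒∣ {{ℕ.m*n≢0 n k}} ζ-primitive (k ℕ.* m) (trans (pow-* ζ k m) ζ^[k*m]≈1))))

  sumR-cong : ∀ {f g} → (∀ r → f r ≈ g r) → ∀ n → sumR f n ≈ sumR g n
  sumR-cong f≈g zero    = refl
  sumR-cong f≈g (suc n) = +-cong (sumR-cong f≈g n) (f≈g n)

  sumR-zero : ∀ {f} n → (∀ {r} → r < n → f r ≈ 0#) → sumR f n ≈ 0#
  sumR-zero zero    _   = refl
  sumR-zero (suc n) f≈0 = trans (+-cong (sumR-zero n (f≈0 ∘ ℕ.m<n⇒m<1+n)) (f≈0 (ℕ.n<1+n n))) (+-identityˡ 0#)

  *-distribˡ-sumR : ∀ x f n → x * sumR f n ≈ sumR (λ r → x * f r) n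
  *-distribˡ-sumR x f zero    = zeroʳ x
  *-distribˡ-sumR x f (suc n) = trans (distribˡ x _ _) (+-congʳ (*-distribˡ-sumR x f n))

  sumR-minus : ∀ f g n → sumR (λ r → f r - g r) n ≈ sumR f n - sumR g n
  sumR-minus f g zero    = sym (trans (+-congˡ -0#≈0#) (+-identityʳ 0#))
  sumR-minus f g (suc n) = begin
    sumR (λ r → f r - g r) n + (f n - g n)  ≈⟨ +-congʳ (sumR-minus f g n) ⟩
    (sumR f n - sumR g n) + (f n - g n)     ≈⟨ interchange _ _ _ _ ⟩
    (sumR f n + f n) + (- sumR g n - g n)   ≈⟨ +-congˡ (-‿+-comm _ _) ⟩
    (sumR f n + f n) - (sumR g n + g n)     ∎

  sumR-+ : ∀ f m n → sumR f (m ℕ.+ n) ≈ sumR f m + sumR (λ j → f (m ℕ.+ j)) n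
  sumR-+ f m zero    = trans (reflexive (≡.cong (sumR f) (ℕ.+-identityʳ m))) (sym (+-identityʳ _))
  sumR-+ f m (suc n) = begin
    sumR f (m ℕ.+ suc n)                                   ≡⟨ ≡.cong (sumR f) (ℕ.+-suc m n) ⟩
    sumR f (m ℕ.+ n) + f (m ℕ.+ n)                         ≈⟨ +-congʳ (sumR-+ f m n) ⟩
    (sumR f m + sumR (λ j → f (m ℕ.+ j)) n) + f (m ℕ.+ n)  ≈⟨ +-assoc _ _ _ ⟩
    sumR f m + (sumR (λ j → f (m ℕ.+ j)) n + f (m ℕ.+ n))  ∎

  sumR-rotate : ∀ h n → h n ≈ h 0 → sumR (h ∘ suc) n ≈ sumR h n
  sumR-rotate h n hn≈h0 = +-cancelˡ (h 0) _ _ (begin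
    h 0 + sumR (h ∘ suc) n        ≈⟨ +-congʳ (+-identityˡ (h 0)) ⟨
    sumR h 1 + sumR (h ∘ suc) n   ≈⟨ sumR-+ h 1 n ⟨
    sumR h n + h n                ≈⟨ +-congˡ hn≈h0 ⟩
    sumR h n + h 0                ≈⟨ +-comm _ _ ⟩
    h 0 + sumR h n                ∎)

  sumR-shift : ∀ h n → (∀ r → h (r ℕ.+ n) ≈ h r) → ∀ s → sumR (λ r → h (r ℕ.+ s)) n ≈ sumR h n
  sumR-shift h n h-periodic zero    = sumR-cong (λ r → reflexive (≡.cong h (ℕ.+-identityʳ r))) n
  sumR-shift h n h-periodic (suc s) = begin
    sumR (λ r → h (r ℕ.+ suc s)) n    ≈⟨ sumR-cong (λ r → reflexive (≡.cong h (ℕ.+-suc r s))) n ⟩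
    sumR (λ r → h (suc (r ℕ.+ s))) n  ≈⟨ sumR-shift (h ∘ suc) n (h-periodic ∘ suc) s ⟩
    sumR (h ∘ suc) n                  ≈⟨ sumR-rotate h n (h-periodic 0) ⟩
    sumR h n                          ∎

  if-cong : ∀ {b b′ x y} → b ≡ b′ → x ≈ y → (if b then x else 0#) ≈ (if b′ then y else 0#)
  if-cong {true}  ≡.refl x≈y = x≈y
  if-cong {false} ≡.refl _   = refl

  if-*ˡ : ∀ b w x → (if b then w * x else 0#) ≈ w * (if b then x else 0#)
  if-*ˡ true  w x = refl
  if-*ˡ false w x = sym (zeroʳ w)

  if-∧-not : ∀ a d x →
    (if a ∧ not d then x else 0#) ≈ (if a then x else 0#) - (if d then (if a then x else 0#) else 0#)
  if-∧-not true  true  x = sym (-‿inverseʳ x)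
  if-∧-not true  false x = sym (trans (+-congˡ -0#≈0#) (+-identityʳ x))
  if-∧-not false true  x = sym (trans (+-congˡ -0#≈0#) (+-identityʳ 0#))
  if-∧-not false false x = sym (trans (+-congˡ -0#≈0#) (+-identityʳ 0#))

  sumR-multiples : ∀ p → .{{NonZero p}} → ∀ (G : ℕ → Carrier) n →
    sumR (λ r → if ⌊ p ∣? r ⌋ then G r else 0#) (n ℕ.* p) ≈ sumR (λ s → G (s ℕ.* p)) n
  sumR-multiples p          G zero    = refl
  sumR-multiples p@(suc p′) G (suc n) = begin
    sumR F (suc n ℕ.* p)                                 ≡⟨ ≡.cong (sumR F) (ℕ.+-comm p (n ℕ.* p)) ⟩
    sumR F (n ℕ.* p ℕ.+ p)                               ≈⟨ sumR-+ F (n ℕ.* p) p ⟩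
    sumR F (n ℕ.* p) + sumR (λ j → F (n ℕ.* p ℕ.+ j)) p  ≈⟨ +-cong (sumR-multiples p G n) block ⟩
    sumR (λ s → G (s ℕ.* p)) n + G (n ℕ.* p)             ∎
    where
    F : ℕ → Carrier
    F r = if ⌊ p ∣? r ⌋ then G r else 0#
    block : sumR (λ j → F (n ℕ.* p ℕ.+ j)) p ≈ G (n ℕ.* p)
    block = begin
      sumR (λ j → F (n ℕ.* p ℕ.+ j)) (1 ℕ.+ p′)
        ≈⟨ sumR-+ _ 1 p′ ⟩
      (0# + F (n ℕ.* p ℕ.+ 0)) + sumR (λ j → F (n ℕ.* p ℕ.+ suc j)) p′
        ≈⟨ +-cong (+-identityˡ _) (sumR-zero p′ off-multiple) ⟩
      F (n ℕ.* p ℕ.+ 0) + 0#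
        ≈⟨ +-identityʳ _ ⟩
      F (n ℕ.* p ℕ.+ 0)
        ≡⟨ ≡.cong F (ℕ.+-identityʳ (n ℕ.* p)) ⟩
      F (n ℕ.* p)
        ≈⟨ if-cong (⌊⌋-true (p ∣? n ℕ.* p) (n∣m*n n)) refl ⟩
      G (n ℕ.* p)
        ∎
      where
      off-multiple : ∀ {j} → j < p′ → F (n ℕ.* p ℕ.+ suc j) ≈ 0#
      off-multiple {j} j<p′ = if-cong (⌊⌋-false (p ∣? n ℕ.* p ℕ.+ suc j) p∤) refl
        where p∤ = λ p∣ → ℕ.<⇒≱ (s≤s j<p′) (∣⇒≤ (∣m+n∣m⇒∣n p∣ (n∣m*n n)))

  powerSum : (ℕ → Bool) → Carrier → ℕ → Carrier
  powerSum f u n = sumR (λ r → if f r then pow u r else 0#) n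

  expSum≈powerSum : ∀ ζ b q a → pow ζ (suc q) ≈ 1# →
    expSum ζ b (suc q) a ≈ powerSum (coprimeTo (gcd (suc q) (b ℕ.^ 3 ℕ.∸ b))) (pow ζ (a %ℕ suc q)) (suc q)
  expSum≈powerSum ζ b q a ζ^q≈1 =
    sumR-cong (λ r → if-cong (ρ≡coprimeTo-gcd b r (suc q)) (pow-%ℕ ζ^q≈1 r a)) (suc q)

module RootsOfUnity {c ℓ} (R : CommutativeRing c ℓ) (isDomain : IsIntegralDomain R) where

  open import Algebra.Properties.Ring (CommutativeRing.ring R)
    using (-1*x≈-x; x∙y⁻¹≈ε⇒x≈y; -0#≈0#; -‿involutive)
  open import Data.Bool using (Bool; if_then_else_)
  open import Data.Integer as ℤ using (+_)
  open import Data.Nat as ℕ using (zero; suc; _<_; NonZero)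
  open import Data.Nat.Divisibility using (_∣_; _∤_; _∣?_; divides; m∣m*n; ∣-antisym; ∣-refl; ∣⇒≤)
  open import Data.Nat.GCD using (gcd[m,n]∣m; gcd[m,n]∣n; gcd-greatest; gcd[m,n]≢0)
  open import Data.Nat.Primality using (Prime; prime⇒nonZero)
  import Data.Nat.Properties as ℕ
  open import Data.Product using (_,_)
  open import Data.Sum using (_⊎_; inj₁; [_,_]′; map₁)
  open import Function using (id)
  open import Relation.Nullary using (yes; no; contradiction)
  open import Relation.Nullary.Decidable using (⌊_⌋)
  open import Relation.Binary.PropositionalEquality as ≡ using (_≡_)
  open Arithmetic
    using ( periodic-multiple; prime-induction; prime>1; coprimeTo; coprimeTo-+; coprimeTo-*-prime
          ; coprimeTo-*-prime-∣; coprimeTo-prime-*; μ-*-prime-∣; μ-*-prime-∤ )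
  open CommutativeRing R
  open RingOps R
  open PowerSums R
  open import Relation.Binary.Reasoning.Setoid setoid

  x*y≈y⇒x≈1⊎y≈0 : ∀ x y → x * y ≈ y → x ≈ 1# ⊎ y ≈ 0#
  x*y≈y⇒x≈1⊎y≈0 x y x*y≈y = map₁ (x∙y⁻¹≈ε⇒x≈y x 1#) (isDomain (x - 1#) y (begin
    (x - 1#) * y       ≈⟨ distribʳ y x (- 1#) ⟩
    x * y + - 1# * y   ≈⟨ +-cong x*y≈y (-1*x≈-x y) ⟩
    y - y              ≈⟨ -‿inverseʳ y ⟩
    0#                 ∎))

  -- Shifting r by g multiplies the sum by u ^ g ≠ 1, yet leaves it unchanged by q-periodicity.
  powerSum-periodic≈0 : ∀ (f : ℕ → Bool) {u q g} → IsPrimitiveRoot u q → 0 < g → g < q → g ∣ q →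
    (∀ r → f (r ℕ.+ g) ≡ f r) → powerSum f u q ≈ 0#
  powerSum-periodic≈0 f {u} {q} {g} (u^q≈1 , minimal) 0<g g<q (divides k ≡.refl) f-periodic =
    [ (λ u^g≈1 → contradiction u^g≈1 (minimal g 0<g g<q)) , id ]′ (x*y≈y⇒x≈1⊎y≈0 (pow u g) _ u^g*S≈S)
    where
    h : ℕ → Carrier
    h r = if f r then pow u r else 0#
    h-periodic : ∀ r → h (r ℕ.+ q) ≈ h r
    h-periodic r = if-cong (periodic-multiple f f-periodic k r) (pow-periodic u^q≈1 r)
    h-twisted : ∀ r → h (r ℕ.+ g) ≈ pow u g * h r
    h-twisted r = trans (if-cong (f-periodic r) (trans (pow-+ u r g) (*-comm _ _))) (if-*ˡ (f r) (pow u g) (pow u r))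
    u^g*S≈S : pow u g * sumR h q ≈ sumR h q
    u^g*S≈S = begin
      pow u g * sumR h q             ≈⟨ *-distribˡ-sumR (pow u g) h q ⟩
      sumR (λ r → pow u g * h r) q   ≈⟨ sumR-cong h-twisted q ⟨
      sumR (λ r → h (r ℕ.+ g)) q     ≈⟨ sumR-shift h q h-periodic g ⟩
      sumR h q                       ∎

  intR-neg : ∀ z → intR (ℤ.- z) ≈ - intR z
  intR-neg (+ zero)     = sym -0#≈0#
  intR-neg (+ suc n)    = refl
  intR-neg ℤ.-[1+ n ]   = sym (-‿involutive _)

  powerSum-coprimeTo-*-prime-∣ : ∀ {n p u} → .{{NonZero n}} → Prime p → p ∣ n →
    IsPrimitiveRoot u (n ℕ.* p) → powerSum (coprimeTo (n ℕ.* p)) u (n ℕ.* p) ≈ 0#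
  powerSum-coprimeTo-*-prime-∣ {n} {p} pp p∣n u-primitive =
    powerSum-periodic≈0 (coprimeTo (n ℕ.* p)) u-primitive (ℕ.>-nonZero⁻¹ n) (ℕ.m<m*n n p (prime>1 pp)) (m∣m*n p)
      (λ r → ≡.trans (coprimeTo-*-prime-∣ pp p∣n (r ℕ.+ n))
               (≡.trans (coprimeTo-+ n r) (≡.sym (coprimeTo-*-prime-∣ pp p∣n r))))

  powerSum-coprimeTo-*-prime-∤ : ∀ {n p u} → .{{NonZero n}} → Prime p → p ∤ n →
    IsPrimitiveRoot u (n ℕ.* p) →
    powerSum (coprimeTo (n ℕ.* p)) u (n ℕ.* p) ≈ - powerSum (coprimeTo n) (pow u p) n
  powerSum-coprimeTo-*-prime-∤ {n} {p} {u} pp p∤n u-primitive = begin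
    powerSum (coprimeTo (n ℕ.* p)) u (n ℕ.* p)
      ≈⟨ sumR-cong inclusion-exclusion (n ℕ.* p) ⟩
    sumR (λ r → A r - (if ⌊ p ∣? r ⌋ then A r else 0#)) (n ℕ.* p)
      ≈⟨ sumR-minus A _ (n ℕ.* p) ⟩
    powerSum (coprimeTo n) u (n ℕ.* p) - sumR (λ r → if ⌊ p ∣? r ⌋ then A r else 0#) (n ℕ.* p)
      ≈⟨ +-cong coprime-to-n≈0 (-‿cong (sumR-multiples p A n)) ⟩
    0# - sumR (λ s → A (s ℕ.* p)) n
      ≈⟨ +-identityˡ _ ⟩
    - sumR (λ s → A (s ℕ.* p)) n
      ≈⟨ -‿cong (sumR-cong (λ s → if-cong (coprimeTo-prime-* pp p∤n s) (pow-*ʳ s)) n) ⟩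
    - powerSum (coprimeTo n) (pow u p) n
      ∎
    where
    instance _ = prime⇒nonZero pp
    A : ℕ → Carrier
    A r = if coprimeTo n r then pow u r else 0#
    inclusion-exclusion : ∀ r →
      (if coprimeTo (n ℕ.* p) r then pow u r else 0#) ≈ A r - (if ⌊ p ∣? r ⌋ then A r else 0#)
    inclusion-exclusion r =
      trans (if-cong (coprimeTo-*-prime {n = n} pp r) refl) (if-∧-not (coprimeTo n r) ⌊ p ∣? r ⌋ (pow u r))
    coprime-to-n≈0 : powerSum (coprimeTo n) u (n ℕ.* p) ≈ 0#
    coprime-to-n≈0 = powerSum-periodic≈0 (coprimeTo n) u-primitive (ℕ.>-nonZero⁻¹ n) (ℕ.m<m*n n p (prime>1 pp))
      (m∣m*n p) (coprimeTo-+ n)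
    pow-*ʳ : ∀ s → pow u (s ℕ.* p) ≈ pow (pow u p) s
    pow-*ʳ s = trans (reflexive (≡.cong (pow u) (ℕ.*-comm s p))) (pow-* u p s)

  powerSum-coprimeTo≈μ : ∀ q → .{{NonZero q}} → ∀ {u} → IsPrimitiveRoot u q →
    powerSum (coprimeTo q) u q ≈ intR (μ q)
  powerSum-coprimeTo≈μ = prime-induction RamanujanSum≈μ base step
    where
    RamanujanSum≈μ : ℕ → Set _
    RamanujanSum≈μ q = ∀ {u} → IsPrimitiveRoot u q → powerSum (coprimeTo q) u q ≈ intR (μ q)
    -- Both sides compute: to 0# + 1# and to 1# + 0#.
    base : RamanujanSum≈μ 1
    base _ = +-comm 0# 1#
    step : ∀ {n p} → .{{NonZero n}} → Prime p → RamanujanSum≈μ n → RamanujanSum≈μ (n ℕ.* p)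
    step {n} {p} pp ih {u} u-primitive with p ∣? n
    ... | yes p∣n = begin
      powerSum (coprimeTo (n ℕ.* p)) u (n ℕ.* p)  ≈⟨ powerSum-coprimeTo-*-prime-∣ pp p∣n u-primitive ⟩
      0#                                          ≡⟨ ≡.cong intR (μ-*-prime-∣ pp p∣n) ⟨
      intR (μ (n ℕ.* p))                          ∎
    ... | no p∤n = begin
      powerSum (coprimeTo (n ℕ.* p)) u (n ℕ.* p)  ≈⟨ powerSum-coprimeTo-*-prime-∤ pp p∤n u-primitive ⟩
      - powerSum (coprimeTo n) (pow u p) n        ≈⟨ -‿cong (ih (primitive-pow-factor u-primitive)) ⟩
      - intR (μ n)                                ≈⟨ intR-neg (μ n) ⟨
      intR (ℤ.- μ n)                              ≡⟨ ≡.cong intR (μ-*-prime-∤ pp p∤n) ⟨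
      intR (μ (n ℕ.* p))                          ∎
      where instance _ = prime⇒nonZero pp

  powerSum-coprimeTo-gcd : ∀ {q u} → .{{_ : NonZero q}} → IsPrimitiveRoot u q → ∀ m →
    powerSum (coprimeTo (gcd q m)) u q ≈ intR (μ q) * intR (if ⌊ q ∣? m ⌋ then + 1 else + 0)
  powerSum-coprimeTo-gcd {q} {u} u-primitive m with q ∣? m
  ... | yes q∣m = begin
    powerSum (coprimeTo (gcd q m)) u q   ≡⟨ ≡.cong (λ g → powerSum (coprimeTo g) u q) gcd[q,m]≡q ⟩
    powerSum (coprimeTo q) u q           ≈⟨ powerSum-coprimeTo≈μ q u-primitive ⟩
    intR (μ q)                           ≈⟨ *-identityʳ _ ⟨
    intR (μ q) * 1#                      ≈⟨ *-congˡ (+-identityʳ 1#) ⟨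
    intR (μ q) * intR (+ 1)              ∎
    where
    gcd[q,m]≡q : gcd q m ≡ q
    gcd[q,m]≡q = ∣-antisym (gcd[m,n]∣m q m) (gcd-greatest ∣-refl q∣m)
  ... | no q∤m = begin
    powerSum (coprimeTo g) u q
      ≈⟨ powerSum-periodic≈0 (coprimeTo g) u-primitive 0<g g<q (gcd[m,n]∣m q m) (coprimeTo-+ g) ⟩
    0#
      ≈⟨ zeroʳ _ ⟨
    intR (μ q) * intR (+ 0)
      ∎
    where
    g = gcd q m
    0<g : 0 < g
    0<g = ℕ.n≢0⇒n>0 (gcd[m,n]≢0 q m (inj₁ (ℕ.≢-nonZero⁻¹ q)))
    g<q : g < q
    g<q = ℕ.≤∧≢⇒< (∣⇒≤ (gcd[m,n]∣m q m)) (λ g≡q → q∤m (≡.subst (_∣ m) g≡q (gcd[m,n]∣n q m)))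

lemma4p3 : ∀ {c ℓ} (R : CommutativeRing c ℓ) → IsIntegralDomain R →
    (b q : ℕ) (a : ℤ) (ζ : CommutativeRing.Carrier R) →
    2 ≤ b → 1 ≤ q → gcd ∣ a ∣ q ≡ 1 → RingOps.IsPrimitiveRoot R ζ q →
    CommutativeRing._≈_ R (RingOps.expSum R ζ b q a)
      (CommutativeRing._*_ R (RingOps.intR R (μ q)) (RingOps.intR R (divInd b q)))
lemma4p3 R isDomain b zero       a ζ _ () _ _
lemma4p3 R isDomain b q@(suc q′) a ζ _ _ gcd[a,q]≡1 ζ-primitive = begin
  expSum ζ b q a
    ≈⟨ expSum≈powerSum ζ b q′ a (proj₁ ζ-primitive) ⟩
  powerSum (coprimeTo (gcd q (b ^ 3 ∸ b))) (pow ζ (a %ℕ q)) q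
    ≈⟨ powerSum-coprimeTo-gcd (primitive-pow-coprime ζ-primitive (gcd≡1⇒coprime-%ℕ a gcd[a,q]≡1)) (b ^ 3 ∸ b) ⟩
  intR (μ q) * intR (divInd b q)
    ∎
  where
  open import Data.Integer.DivMod using (_%ℕ_)
  open import Data.Nat using (_^_; _∸_)
  open import Data.Product using (proj₁)
  open CommutativeRing R
  open RingOps R
  open PowerSums R
  open RootsOfUnity R isDomain
  open Arithmetic using (coprimeTo; gcd≡1⇒coprime-%ℕ)
  open import Relation.Binary.Reasoning.Setoid setoid
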